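{- Let $p \in \mathbb{Z}[x]$ be a monic polynomial and suppose $p = qr$ with $q, r \in \mathbb{Z}[x]$. Then (i) $p$ is type 2 if and only if $q$ and $r$ are both type 2; (ii) $p$ is weakly type 2 if and only if $q$ and $r$ are both weakly type 2 and at least one of them is type 2.
   Context: A monic polynomial $p(x) = \sum_{i=0}^n a_i x^{n-i} \in \mathbb{Z}[x]$ is called type 2 if $2^i$ divides $a_i$ for all $i \geqslant 0$, and weakly type 2 if $2^{i-1}$ divides $a_i$ for all $i \geqslant 1$. -}

module Defs where

open import Data.Nat using (ℕ; zero; suc; _^_; _∸_; _≤_; _<_)
open import Data.Integer using (ℤ; +_; 0ℤ; 1ℤ) renaming (_+_ to _+ℤ_; _*_ to _*ℤ_)
open import Data.Integer.Divisibility using (_∣_)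
open import Data.List using (List; []; _∷_; map)
open import Data.Product using (∃; _×_)
open import Relation.Binary.PropositionalEquality using (_≡_; _≢_)

-- A polynomial in ℤ[x] is represented by its list of coefficients in
-- ascending order of degree: a ∷ as  represents  a + x·(as).
-- Trailing zeros are allowed; equality of polynomials is coefficientwise.
Poly : Set
Poly = List ℤ

coeff : Poly → ℕ → ℤ
coeff []       k       = 0ℤ
coeff (a ∷ p)  zero    = a
coeff (a ∷ p)  (suc k) = coeff p k

_⊕_ : Poly → Poly → Poly
[]      ⊕ q       = q
(a ∷ p) ⊕ []      = a ∷ p
(a ∷ p) ⊕ (b ∷ q) = (a +ℤ b) ∷ (p ⊕ q)

_⊗_ : Poly → Poly → Poly
[]      ⊗ q = []
(a ∷ p) ⊗ q = map (a *ℤ_) q ⊕ (0ℤ ∷ (p ⊗ q))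

_≈P_ : Poly → Poly → Set
p ≈P q = ∀ k → coeff p k ≡ coeff q k

HasDegree : Poly → ℕ → Set
HasDegree f d = coeff f d ≢ 0ℤ × (∀ k → d < k → coeff f k ≡ 0ℤ)

Monic : Poly → Set
Monic f = ∃ λ d → HasDegree f d × coeff f d ≡ 1ℤ

-- Writing f = Σ_{i=0}^{n} a_i x^{n-i} with n = deg f, so a_i = coeff f (n ∸ i):
-- type 2:        2^i ∣ a_i  for all 0 ≤ i ≤ n
Type2 : Poly → Set
Type2 f = ∀ n → HasDegree f n → ∀ i → i ≤ n → (+ (2 ^ i)) ∣ coeff f (n ∸ i)

WeaklyType2 : Poly → Set
WeaklyType2 f = ∀ n → HasDegree f n → ∀ i → 1 ≤ i → i ≤ n → (+ (2 ^ (i ∸ 1))) ∣ coeff f (n ∸ i)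

module Submission where

-- Write f₂(x) = f(2x). If f has degree m, then f is type 2 iff 2ᵐ divides every
-- coefficient of f₂, and weakly type 2 iff 2ᵐ divides every coefficient of 2f₂.
-- Since (qr)₂ = q₂r₂, Gauss's lemma splits a power 2ⁿ dividing the content of p₂ (resp.
-- 2p₂ = 2q₂·r₂), n = deg q + deg r, into powers 2ᵃ, 2ᵇ dividing the contents of the two
-- factors with a + b = n. As p is monic, q and r have leading coefficients ±1, so the
-- leading coefficients ±2^deg q of q₂ and ±2^(deg q + 1) of 2q₂ bound a. In (i) this
-- forces a = deg q and b = deg r; in (ii) either a = deg q, and r is type 2, or
-- a = deg q + 1, and q is type 2.

open import Defs

open import Data.Empty using (⊥-elim)
open import Data.Integer as ℤ using (ℤ; +_; 0ℤ; 1ℤ; _+_; _*_)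
open import Data.Integer.Divisibility.Signed as ∣ᶻ using (_∣_; divides)
import Data.Integer.Properties as ℤ
open import Data.Integer.Tactic.RingSolver using (solve-∀)
open import Data.List using ([]; _∷_; map)
open import Data.Nat as ℕ using (ℕ; zero; suc; _<_; _≤_; s≤s; z≤n; _^_; _∸_)
import Data.Nat.Divisibility as ℕ
open import Data.Nat.Primality using (Prime; prime?; prime⇒nonZero; euclidsLemma)
import Data.Nat.Properties as ℕ
open import Data.Product using (_×_; ∃; ∃₂; _,_; proj₁; proj₂; uncurry)
open import Data.Sum using (_⊎_; inj₁; inj₂; [_,_]′)
open import Function.Base using (_∘_)
open import Function.Bundles using (_⇔_; mk⇔)
open import Relation.Binary.Definitions using (Tri; tri<; tri≈; tri>)
open import Relation.Binary.PropositionalEquality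
open import Relation.Nullary using (Dec; yes; no; ¬_)
open import Relation.Nullary.Decidable using (from-yes)

scale : ℤ → Poly → Poly
scale c = map (c *_)

coeff-⊕ : ∀ f g k → coeff (f ⊕ g) k ≡ coeff f k + coeff g k
coeff-⊕ []      g       k       = sym (ℤ.+-identityˡ _)
coeff-⊕ (a ∷ f) []      k       = sym (ℤ.+-identityʳ _)
coeff-⊕ (a ∷ f) (b ∷ g) zero    = refl
coeff-⊕ (a ∷ f) (b ∷ g) (suc k) = coeff-⊕ f g k

coeff-scale : ∀ c f k → coeff (scale c f) k ≡ c * coeff f k
coeff-scale c []      k       = sym (ℤ.*-zeroʳ c)
coeff-scale c (a ∷ f) zero    = refl
coeff-scale c (a ∷ f) (suc k) = coeff-scale c f k

coeff-∷⊗-zero : ∀ a f g → coeff ((a ∷ f) ⊗ g) zero ≡ a * coeff g zero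
coeff-∷⊗-zero a f g = begin
  coeff (scale a g ⊕ (0ℤ ∷ f ⊗ g)) zero ≡⟨ coeff-⊕ (scale a g) _ zero ⟩
  coeff (scale a g) zero + 0ℤ           ≡⟨ ℤ.+-identityʳ _ ⟩
  coeff (scale a g) zero                ≡⟨ coeff-scale a g zero ⟩
  a * coeff g zero                      ∎
  where open ≡-Reasoning

coeff-∷⊗-suc : ∀ a f g k →
  coeff ((a ∷ f) ⊗ g) (suc k) ≡ a * coeff g (suc k) + coeff (f ⊗ g) k
coeff-∷⊗-suc a f g k = trans (coeff-⊕ (scale a g) _ (suc k))
  (cong (_+ coeff (f ⊗ g) k) (coeff-scale a g (suc k)))

coeff-⊗∷-zero : ∀ f b g → coeff (f ⊗ (b ∷ g)) zero ≡ coeff f zero * b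
coeff-⊗∷-zero []      b g = refl
coeff-⊗∷-zero (a ∷ f) b g = coeff-∷⊗-zero a f (b ∷ g)

coeff-⊗∷-suc : ∀ f b g k →
  coeff (f ⊗ (b ∷ g)) (suc k) ≡ coeff f (suc k) * b + coeff (f ⊗ g) k
coeff-⊗∷-suc []      b g k = refl
coeff-⊗∷-suc (a ∷ f) b g zero = begin
  coeff ((a ∷ f) ⊗ (b ∷ g)) 1             ≡⟨ coeff-∷⊗-suc a f (b ∷ g) zero ⟩
  a * coeff g zero + coeff (f ⊗ (b ∷ g)) 0 ≡⟨ cong (λ v → a * coeff g zero + v) (coeff-⊗∷-zero f b g) ⟩
  a * coeff g zero + coeff f zero * b     ≡⟨ ℤ.+-comm (a * coeff g zero) _ ⟩
  coeff f zero * b + a * coeff g zero     ≡⟨ cong (λ v → coeff f zero * b + v) (coeff-∷⊗-zero a f g) ⟨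
  coeff f zero * b + coeff ((a ∷ f) ⊗ g) 0 ∎
  where open ≡-Reasoning
coeff-⊗∷-suc (a ∷ f) b g (suc k) = begin
  coeff ((a ∷ f) ⊗ (b ∷ g)) (2 ℕ.+ k)
    ≡⟨ coeff-∷⊗-suc a f (b ∷ g) (suc k) ⟩
  a * coeff g (suc k) + coeff (f ⊗ (b ∷ g)) (suc k)
    ≡⟨ cong (λ v → a * coeff g (suc k) + v) (coeff-⊗∷-suc f b g k) ⟩
  a * coeff g (suc k) + (coeff f (suc k) * b + coeff (f ⊗ g) k)
    ≡⟨ swap (a * coeff g (suc k)) (coeff f (suc k) * b) (coeff (f ⊗ g) k) ⟩
  coeff f (suc k) * b + (a * coeff g (suc k) + coeff (f ⊗ g) k)
    ≡⟨ cong (λ v → coeff f (suc k) * b + v) (coeff-∷⊗-suc a f g k) ⟨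
  coeff f (suc k) * b + coeff ((a ∷ f) ⊗ g) (suc k)
    ∎
  where
  open ≡-Reasoning
  swap : ∀ x y z → x + (y + z) ≡ y + (x + z)
  swap = solve-∀

coeff-scale-⊗ : ∀ c f g k → coeff (scale c f ⊗ g) k ≡ c * coeff (f ⊗ g) k
coeff-scale-⊗ c []      g k       = sym (ℤ.*-zeroʳ c)
coeff-scale-⊗ c (a ∷ f) g zero    = begin
  coeff ((c * a ∷ scale c f) ⊗ g) zero ≡⟨ coeff-∷⊗-zero (c * a) (scale c f) g ⟩
  c * a * coeff g zero                 ≡⟨ ℤ.*-assoc c a _ ⟩
  c * (a * coeff g zero)               ≡⟨ cong (c *_) (coeff-∷⊗-zero a f g) ⟨
  c * coeff ((a ∷ f) ⊗ g) zero         ∎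
  where open ≡-Reasoning
coeff-scale-⊗ c (a ∷ f) g (suc k) = begin
  coeff ((c * a ∷ scale c f) ⊗ g) (suc k)
    ≡⟨ coeff-∷⊗-suc (c * a) (scale c f) g k ⟩
  c * a * coeff g (suc k) + coeff (scale c f ⊗ g) k
    ≡⟨ cong (λ v → c * a * coeff g (suc k) + v) (coeff-scale-⊗ c f g k) ⟩
  c * a * coeff g (suc k) + c * coeff (f ⊗ g) k
    ≡⟨ factor c a (coeff g (suc k)) (coeff (f ⊗ g) k) ⟩
  c * (a * coeff g (suc k) + coeff (f ⊗ g) k)
    ≡⟨ cong (c *_) (coeff-∷⊗-suc a f g k) ⟨
  c * coeff ((a ∷ f) ⊗ g) (suc k)
    ∎
  where
  open ≡-Reasoning
  factor : ∀ c a x y → c * a * x + c * y ≡ c * (a * x + y)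
  factor = solve-∀

coeff-⊗-scale : ∀ c f g k → coeff (f ⊗ scale c g) k ≡ c * coeff (f ⊗ g) k
coeff-⊗-scale c []      g k       = sym (ℤ.*-zeroʳ c)
coeff-⊗-scale c (a ∷ f) g zero    = begin
  coeff ((a ∷ f) ⊗ scale c g) zero ≡⟨ coeff-∷⊗-zero a f (scale c g) ⟩
  a * coeff (scale c g) zero       ≡⟨ cong (a *_) (coeff-scale c g zero) ⟩
  a * (c * coeff g zero)           ≡⟨ ℤ.*-comm a _ ⟩
  c * coeff g zero * a             ≡⟨ ℤ.*-assoc c _ a ⟩
  c * (coeff g zero * a)           ≡⟨ cong (c *_) (ℤ.*-comm _ a) ⟩
  c * (a * coeff g zero)           ≡⟨ cong (c *_) (coeff-∷⊗-zero a f g) ⟨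
  c * coeff ((a ∷ f) ⊗ g) zero     ∎
  where open ≡-Reasoning
coeff-⊗-scale c (a ∷ f) g (suc k) = begin
  coeff ((a ∷ f) ⊗ scale c g) (suc k)
    ≡⟨ coeff-∷⊗-suc a f (scale c g) k ⟩
  a * coeff (scale c g) (suc k) + coeff (f ⊗ scale c g) k
    ≡⟨ cong₂ (λ u v → a * u + v) (coeff-scale c g (suc k)) (coeff-⊗-scale c f g k) ⟩
  a * (c * coeff g (suc k)) + c * coeff (f ⊗ g) k
    ≡⟨ factor c a (coeff g (suc k)) (coeff (f ⊗ g) k) ⟩
  c * (a * coeff g (suc k) + coeff (f ⊗ g) k)
    ≡⟨ cong (c *_) (coeff-∷⊗-suc a f g k) ⟨
  c * coeff ((a ∷ f) ⊗ g) (suc k)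
    ∎
  where
  open ≡-Reasoning
  factor : ∀ c a x y → a * (c * x) + c * y ≡ c * (a * x + y)
  factor = solve-∀

-- Dilation f(x) ↦ f(d·x)

infixr 8 _^ᶻ_

_^ᶻ_ : ℕ → ℕ → ℤ
d ^ᶻ n = + (d ^ n)

^ᶻ-suc : ∀ d n → d ^ᶻ suc n ≡ + d * d ^ᶻ n
^ᶻ-suc d n = ℤ.pos-* d (d ^ n)

^ᶻ-+ : ∀ d m n → d ^ᶻ (m ℕ.+ n) ≡ d ^ᶻ m * d ^ᶻ n
^ᶻ-+ d m n = trans (cong +_ (ℕ.^-distribˡ-+-* d m n)) (ℤ.pos-* (d ^ m) (d ^ n))

dilate : ℕ → Poly → Poly
dilate d []      = []
dilate d (a ∷ f) = a ∷ scale (+ d) (dilate d f)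

coeff-dilate : ∀ d f k → coeff (dilate d f) k ≡ d ^ᶻ k * coeff f k
coeff-dilate d []      k       = sym (ℤ.*-zeroʳ (d ^ᶻ k))
coeff-dilate d (a ∷ f) zero    = sym (ℤ.*-identityˡ a)
coeff-dilate d (a ∷ f) (suc k) = begin
  coeff (scale (+ d) (dilate d f)) k ≡⟨ coeff-scale (+ d) (dilate d f) k ⟩
  + d * coeff (dilate d f) k         ≡⟨ cong (+ d *_) (coeff-dilate d f k) ⟩
  + d * (d ^ᶻ k * coeff f k)         ≡⟨ ℤ.*-assoc (+ d) (d ^ᶻ k) _ ⟨
  + d * d ^ᶻ k * coeff f k           ≡⟨ cong (_* coeff f k) (^ᶻ-suc d k) ⟨
  d ^ᶻ suc k * coeff f k             ∎
  where open ≡-Reasoning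

coeff-dilate-⊗ : ∀ d f g k →
  coeff (dilate d f ⊗ dilate d g) k ≡ d ^ᶻ k * coeff (f ⊗ g) k
coeff-dilate-⊗ d []      g k    = sym (ℤ.*-zeroʳ (d ^ᶻ k))
coeff-dilate-⊗ d (a ∷ f) g zero = begin
  coeff ((a ∷ scale (+ d) (dilate d f)) ⊗ dilate d g) zero
    ≡⟨ coeff-∷⊗-zero a (scale (+ d) (dilate d f)) (dilate d g) ⟩
  a * coeff (dilate d g) zero
    ≡⟨ cong (a *_) (trans (coeff-dilate d g zero) (ℤ.*-identityˡ _)) ⟩
  a * coeff g zero
    ≡⟨ coeff-∷⊗-zero a f g ⟨
  coeff ((a ∷ f) ⊗ g) zero
    ≡⟨ ℤ.*-identityˡ _ ⟨
  1ℤ * coeff ((a ∷ f) ⊗ g) zero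
    ∎
  where open ≡-Reasoning
coeff-dilate-⊗ d (a ∷ f) g (suc k) = begin
  coeff ((a ∷ scale (+ d) (dilate d f)) ⊗ dilate d g) (suc k)
    ≡⟨ coeff-∷⊗-suc a (scale (+ d) (dilate d f)) (dilate d g) k ⟩
  a * coeff (dilate d g) (suc k) + coeff (scale (+ d) (dilate d f) ⊗ dilate d g) k
    ≡⟨ cong₂ (λ u v → a * u + v) (coeff-dilate d g (suc k)) (coeff-scale-⊗ (+ d) (dilate d f) _ k) ⟩
  a * (d ^ᶻ suc k * coeff g (suc k)) + + d * coeff (dilate d f ⊗ dilate d g) k
    ≡⟨ cong₂ (λ u v → a * (u * coeff g (suc k)) + + d * v) (^ᶻ-suc d k) (coeff-dilate-⊗ d f g k) ⟩
  a * (+ d * d ^ᶻ k * coeff g (suc k)) + + d * (d ^ᶻ k * coeff (f ⊗ g) k)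
    ≡⟨ factor a (+ d) (d ^ᶻ k) (coeff g (suc k)) (coeff (f ⊗ g) k) ⟩
  + d * d ^ᶻ k * (a * coeff g (suc k) + coeff (f ⊗ g) k)
    ≡⟨ cong₂ _*_ (^ᶻ-suc d k) (coeff-∷⊗-suc a f g k) ⟨
  d ^ᶻ suc k * coeff ((a ∷ f) ⊗ g) (suc k)
    ∎
  where
  open ≡-Reasoning
  factor : ∀ a d t x y → a * (d * t * x) + d * (t * y) ≡ d * t * (a * x + y)
  factor = solve-∀

VanishesAbove : Poly → ℕ → Set
VanishesAbove f d = ∀ k → d < k → coeff f k ≡ 0ℤ

hasDegree-unique : ∀ {f m n} → HasDegree f m → HasDegree f n → m ≡ n
hasDegree-unique {m = m} {n} (fₘ≢0 , f>m≡0) (fₙ≢0 , f>n≡0) with ℕ.<-cmp m n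
... | tri< m<n _ _ = ⊥-elim (fₙ≢0 (f>m≡0 n m<n))
... | tri≈ _ m≡n _ = m≡n
... | tri> _ _ n<m = ⊥-elim (fₘ≢0 (f>n≡0 m n<m))

zero⊎hasDegree : ∀ f → f ≈P [] ⊎ ∃ (HasDegree f)
zero⊎hasDegree []      = inj₁ (λ k → refl)
zero⊎hasDegree (a ∷ f) with zero⊎hasDegree f
... | inj₂ (d , f_d≢0 , f>d≡0) =
  inj₂ (suc d , f_d≢0 , λ { (suc k) (s≤s d<k) → f>d≡0 k d<k })
... | inj₁ f≈0 with a ℤ.≟ 0ℤ
...   | yes a≡0 = inj₁ λ { zero → a≡0 ; (suc k) → f≈0 k }
...   | no  a≢0 = inj₂ (0 , a≢0 , λ { (suc k) _ → f≈0 k })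

⊗-zeroˡ : ∀ f g → f ≈P [] → (f ⊗ g) ≈P []
⊗-zeroˡ []      g f≈0 k       = refl
⊗-zeroˡ (a ∷ f) g f≈0 zero    = begin
  coeff ((a ∷ f) ⊗ g) zero ≡⟨ coeff-∷⊗-zero a f g ⟩
  a * coeff g zero         ≡⟨ cong (_* coeff g zero) (f≈0 zero) ⟩
  0ℤ * coeff g zero        ≡⟨ ℤ.*-zeroˡ (coeff g zero) ⟩
  0ℤ                       ∎
  where open ≡-Reasoning
⊗-zeroˡ (a ∷ f) g f≈0 (suc k) = begin
  coeff ((a ∷ f) ⊗ g) (suc k)            ≡⟨ coeff-∷⊗-suc a f g k ⟩
  a * coeff g (suc k) + coeff (f ⊗ g) k  ≡⟨ cong₂ (λ u v → u * coeff g (suc k) + v) (f≈0 zero) (⊗-zeroˡ f g (f≈0 ∘ suc) k) ⟩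
  0ℤ * coeff g (suc k) + 0ℤ              ≡⟨ cong (_+ 0ℤ) (ℤ.*-zeroˡ (coeff g (suc k))) ⟩
  0ℤ                                     ∎
  where open ≡-Reasoning

⊗-zeroʳ : ∀ f g → g ≈P [] → (f ⊗ g) ≈P []
⊗-zeroʳ []      g g≈0 k       = refl
⊗-zeroʳ (a ∷ f) g g≈0 zero    = trans (coeff-∷⊗-zero a f g) (trans (cong (a *_) (g≈0 zero)) (ℤ.*-zeroʳ a))
⊗-zeroʳ (a ∷ f) g g≈0 (suc k) = begin
  coeff ((a ∷ f) ⊗ g) (suc k)            ≡⟨ coeff-∷⊗-suc a f g k ⟩
  a * coeff g (suc k) + coeff (f ⊗ g) k  ≡⟨ cong₂ (λ u v → a * u + v) (g≈0 (suc k)) (⊗-zeroʳ f g g≈0 k) ⟩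
  a * 0ℤ + 0ℤ                            ≡⟨ cong (_+ 0ℤ) (ℤ.*-zeroʳ a) ⟩
  0ℤ                                     ∎
  where open ≡-Reasoning

coeff-∷⊗-of-≈[] : ∀ a f g → f ≈P [] → ∀ k → coeff ((a ∷ f) ⊗ g) k ≡ a * coeff g k
coeff-∷⊗-of-≈[] a f g f≈0 zero    = coeff-∷⊗-zero a f g
coeff-∷⊗-of-≈[] a f g f≈0 (suc k) = begin
  coeff ((a ∷ f) ⊗ g) (suc k)           ≡⟨ coeff-∷⊗-suc a f g k ⟩
  a * coeff g (suc k) + coeff (f ⊗ g) k ≡⟨ cong (λ v → a * coeff g (suc k) + v) (⊗-zeroˡ f g f≈0 k) ⟩
  a * coeff g (suc k) + 0ℤ              ≡⟨ ℤ.+-identityʳ _ ⟩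
  a * coeff g (suc k)                   ∎
  where open ≡-Reasoning

⊗-vanishesAbove : ∀ f g m l → VanishesAbove f m → VanishesAbove g l →
                  VanishesAbove (f ⊗ g) (m ℕ.+ l)
⊗-vanishesAbove []      g m       l _   _   _       _ = refl
⊗-vanishesAbove (a ∷ f) g zero    l f>0 g>l k       l<k = begin
  coeff ((a ∷ f) ⊗ g) k ≡⟨ coeff-∷⊗-of-≈[] a f g (λ i → f>0 (suc i) (s≤s z≤n)) k ⟩
  a * coeff g k         ≡⟨ cong (a *_) (g>l k l<k) ⟩
  a * 0ℤ                ≡⟨ ℤ.*-zeroʳ a ⟩
  0ℤ                    ∎
  where open ≡-Reasoning
⊗-vanishesAbove (a ∷ f) g (suc m) l f>m g>l (suc k) (s≤s m+l<k) = begin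
  coeff ((a ∷ f) ⊗ g) (suc k)           ≡⟨ coeff-∷⊗-suc a f g k ⟩
  a * coeff g (suc k) + coeff (f ⊗ g) k ≡⟨ cong₂ (λ u v → a * u + v) (g>l (suc k) l<1+k) f⊗g>m+l ⟩
  a * 0ℤ + 0ℤ                           ≡⟨ cong (_+ 0ℤ) (ℤ.*-zeroʳ a) ⟩
  0ℤ                                    ∎
  where
  open ≡-Reasoning
  l<1+k : l < suc k
  l<1+k = s≤s (ℕ.≤-trans (ℕ.m≤n+m l m) (ℕ.<⇒≤ m+l<k))
  f⊗g>m+l : coeff (f ⊗ g) k ≡ 0ℤ
  f⊗g>m+l = ⊗-vanishesAbove f g m l (λ i m<i → f>m (suc i) (s≤s m<i)) g>l k m+l<k

coeff-⊗-top : ∀ f g m l → VanishesAbove f m → VanishesAbove g l →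
              coeff (f ⊗ g) (m ℕ.+ l) ≡ coeff f m * coeff g l
coeff-⊗-top []      g m       l _   _   = sym (ℤ.*-zeroˡ (coeff g l))
coeff-⊗-top (a ∷ f) g zero    l f>0 g>l = coeff-∷⊗-of-≈[] a f g (λ i → f>0 (suc i) (s≤s z≤n)) l
coeff-⊗-top (a ∷ f) g (suc m) l f>m g>l = begin
  coeff ((a ∷ f) ⊗ g) (suc (m ℕ.+ l))                     ≡⟨ coeff-∷⊗-suc a f g (m ℕ.+ l) ⟩
  a * coeff g (suc (m ℕ.+ l)) + coeff (f ⊗ g) (m ℕ.+ l)   ≡⟨ cong₂ (λ u v → a * u + v) (g>l _ (s≤s (ℕ.m≤n+m l m))) IH ⟩
  a * 0ℤ + coeff f m * coeff g l                          ≡⟨ cong (_+ coeff f m * coeff g l) (ℤ.*-zeroʳ a) ⟩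
  0ℤ + coeff f m * coeff g l                              ≡⟨ ℤ.+-identityˡ _ ⟩
  coeff f m * coeff g l                                   ∎
  where
  open ≡-Reasoning
  IH : coeff (f ⊗ g) (m ℕ.+ l) ≡ coeff f m * coeff g l
  IH = coeff-⊗-top f g m l (λ i m<i → f>m (suc i) (s≤s m<i)) g>l

⊗-hasDegree : ∀ {f g m l} → HasDegree f m → HasDegree g l → HasDegree (f ⊗ g) (m ℕ.+ l)
⊗-hasDegree {f} {g} {m} {l} (fₘ≢0 , f>m) (gₗ≢0 , g>l) = top≢0 , ⊗-vanishesAbove f g m l f>m g>l
  where
  top≢0 : coeff (f ⊗ g) (m ℕ.+ l) ≢ 0ℤ
  top≢0 top≡0 with ℤ.i*j≡0⇒i≡0∨j≡0 (coeff f m) (trans (sym (coeff-⊗-top f g m l f>m g>l)) top≡0)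
  ... | inj₁ fₘ≡0 = fₘ≢0 fₘ≡0
  ... | inj₂ gₗ≡0 = gₗ≢0 gₗ≡0

hasDegree-resp-≈ : ∀ {f g d} → f ≈P g → HasDegree g d → HasDegree f d
hasDegree-resp-≈ f≈g (g_d≢0 , g>d) = (λ f_d≡0 → g_d≢0 (trans (sym (f≈g _)) f_d≡0)) ,
                                     (λ k d<k → trans (f≈g k) (g>d k d<k))

-- Gauss's lemma for the p-adic content

infix 4 _∣ᶜ_

record _∣ᶜ_ (d : ℤ) (f : Poly) : Set where
  constructor coeffs-∣
  field ∣-coeff : ∀ k → d ∣ coeff f k

open _∣ᶜ_

∣-zero : ∀ d → d ∣ 0ℤ
∣-zero d = ∣ᶻ.∣ᵤ⇒∣ (ℤ.∣ d ∣ ℕ.∣0)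

∣ᶜ-[] : ∀ d → d ∣ᶜ []
∣ᶜ-[] d = coeffs-∣ λ _ → ∣-zero d

1∣ᶜ : ∀ f → 1ℤ ∣ᶜ f
1∣ᶜ f = coeffs-∣ λ k → ∣ᶻ.∣ᵤ⇒∣ (ℕ.1∣ ℤ.∣ coeff f k ∣)

∣ᶜ-resp-≈ : ∀ {d f g} → f ≈P g → d ∣ᶜ f → d ∣ᶜ g
∣ᶜ-resp-≈ f≈g (coeffs-∣ d∣f) = coeffs-∣ λ k → subst (_ ∣_) (f≈g k) (d∣f k)

∣-∣ᶜ-trans : ∀ {d e f} → d ∣ e → e ∣ᶜ f → d ∣ᶜ f
∣-∣ᶜ-trans d∣e (coeffs-∣ e∣f) = coeffs-∣ λ k → ∣ᶻ.∣-trans d∣e (e∣f k)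

∷-∣ᶜ : ∀ {d a f} → d ∣ a → d ∣ᶜ f → d ∣ᶜ (a ∷ f)
∷-∣ᶜ d∣a (coeffs-∣ d∣f) = coeffs-∣ λ { zero → d∣a ; (suc k) → d∣f k }

∣ᶜ-head : ∀ {d a f} → d ∣ᶜ (a ∷ f) → d ∣ a
∣ᶜ-head d∣af = ∣-coeff d∣af zero

∣ᶜ-tail : ∀ {d a f} → d ∣ᶜ (a ∷ f) → d ∣ᶜ f
∣ᶜ-tail d∣af = coeffs-∣ (∣-coeff d∣af ∘ suc)

∣ᶜ-scale : ∀ c {d f} → d ∣ᶜ f → c * d ∣ᶜ scale c f
∣ᶜ-scale c {f = f} (coeffs-∣ d∣f) =
  coeffs-∣ λ k → subst (_ ∣_) (sym (coeff-scale c f k)) (∣ᶻ.*-monoʳ-∣ c (d∣f k))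

∣ᶜ-scale-cancel : ∀ c {d f} .{{_ : ℤ.NonZero c}} → c * d ∣ᶜ scale c f → d ∣ᶜ f
∣ᶜ-scale-cancel c {f = f} (coeffs-∣ cd∣cf) =
  coeffs-∣ λ k → ∣ᶻ.*-cancelˡ-∣ c (subst (_ ∣_) (coeff-scale c f k) (cd∣cf k))

*-pres-∣ : ∀ {d e x y} → d ∣ x → e ∣ y → d * e ∣ x * y
*-pres-∣ {d} {e} {x} d∣x e∣y = ∣ᶻ.∣-trans (∣ᶻ.*-monoˡ-∣ e d∣x) (∣ᶻ.*-monoʳ-∣ x e∣y)

∣ᶜ-⊗ : ∀ {d e f g} → d ∣ᶜ f → e ∣ᶜ g → d * e ∣ᶜ f ⊗ g
∣ᶜ-⊗ {f = []}    _   _   = ∣ᶜ-[] _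
∣ᶜ-⊗ {f = a ∷ f} {g} d∣f e∣g = coeffs-∣ λ where
  zero    → subst (_ ∣_) (sym (coeff-∷⊗-zero a f g))
              (*-pres-∣ (∣ᶜ-head d∣f) (∣-coeff e∣g zero))
  (suc k) → subst (_ ∣_) (sym (coeff-∷⊗-suc a f g k))
              (∣ᶻ.∣m∣n⇒∣m+n (*-pres-∣ (∣ᶜ-head d∣f) (∣-coeff e∣g (suc k)))
                            (∣-coeff (∣ᶜ-⊗ (∣ᶜ-tail d∣f) e∣g) k))

^ᶻ∣ᶜ-⊗ : ∀ d m l {f g} → d ^ᶻ m ∣ᶜ f → d ^ᶻ l ∣ᶜ g → d ^ᶻ (m ℕ.+ l) ∣ᶜ f ⊗ g
^ᶻ∣ᶜ-⊗ d m l ∣f ∣g = subst (_∣ᶜ _) (sym (^ᶻ-+ d m l)) (∣ᶜ-⊗ ∣f ∣g)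

^ᶻ∣^ᶻsuc : ∀ d n → d ^ᶻ n ∣ d ^ᶻ suc n
^ᶻ∣^ᶻsuc d n = ∣ᶻ.∣ᵤ⇒∣ (ℕ.n∣m*n d)

module _ {p : ℕ} (prime : Prime p) where

  private instance
    p≢0 : ℕ.NonZero p
    p≢0 = prime⇒nonZero prime

  prime∣*⇒∣⊎∣ : ∀ s t → + p ∣ s * t → + p ∣ s ⊎ + p ∣ t
  prime∣*⇒∣⊎∣ s t p∣st with euclidsLemma ℤ.∣ s ∣ ℤ.∣ t ∣ prime (subst (p ℕ.∣_) (ℤ.abs-* s t) (∣ᶻ.∣⇒∣ᵤ p∣st))
  ... | inj₁ p∣s = inj₁ (∣ᶻ.∣ᵤ⇒∣ p∣s)
  ... | inj₂ p∣t = inj₂ (∣ᶻ.∣ᵤ⇒∣ p∣t)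

  -- Write x = s pᵃ and y = t pᵇ; then p ∣ s t, and Euclid's lemma applies.
  ^ᶻ∣*-split : ∀ a b {x y} → p ^ᶻ a ∣ x → p ^ᶻ b ∣ y → p ^ᶻ suc (a ℕ.+ b) ∣ x * y →
               p ^ᶻ suc a ∣ x ⊎ p ^ᶻ suc b ∣ y
  ^ᶻ∣*-split a b (divides s refl) (divides t refl) p^[1+a+b]∣xy =
    [ inj₁ ∘ raise a s , inj₂ ∘ raise b t ]′ (prime∣*⇒∣⊎∣ s t p∣st)
    where
    raise : ∀ n s → + p ∣ s → p ^ᶻ suc n ∣ s * p ^ᶻ n
    raise n s p∣s = subst (_∣ s * p ^ᶻ n) (sym (^ᶻ-suc p n)) (∣ᶻ.*-monoˡ-∣ (p ^ᶻ n) p∣s)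
    rearrange : ∀ s t x y → s * x * (t * y) ≡ x * y * (s * t)
    rearrange = solve-∀
    p∣st : + p ∣ s * t
    p∣st = ∣ᶻ.*-cancelˡ-∣ (p ^ᶻ (a ℕ.+ b)) {{ℕ.m^n≢0 p (a ℕ.+ b)}} (subst₂ _∣_
      (trans (^ᶻ-suc p (a ℕ.+ b)) (ℤ.*-comm (+ p) _))
      (trans (rearrange s t _ _) (cong (_* (s * t)) (sym (^ᶻ-+ p a b))))
      p^[1+a+b]∣xy)

  -- Peel off the constant terms: whichever factor gains a power of p at its constant
  -- term can be dropped from the product without losing the divisibility of the rest.
  gauss-step : ∀ a b f g → p ^ᶻ suc (a ℕ.+ b) ∣ᶜ f ⊗ g → p ^ᶻ a ∣ᶜ f → p ^ᶻ b ∣ᶜ g →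
               p ^ᶻ suc a ∣ᶜ f ⊎ p ^ᶻ suc b ∣ᶜ g
  gauss-step a b []      g       _ _ _ = inj₁ (∣ᶜ-[] _)
  gauss-step a b (c ∷ f) []      _ _ _ = inj₂ (∣ᶜ-[] _)
  gauss-step a b (c ∷ f) (e ∷ g) ∣fg ∣f ∣g =
    [ (λ ∣c → [ inj₁ ∘ ∷-∣ᶜ ∣c , inj₂ ]′ (gauss-step a b f (e ∷ g) (drop-c ∣c) (∣ᶜ-tail ∣f) ∣g))
    , (λ ∣e → [ inj₁ , inj₂ ∘ ∷-∣ᶜ ∣e ]′ (gauss-step a b (c ∷ f) g (drop-e ∣e) ∣f (∣ᶜ-tail ∣g)))
    ]′ (^ᶻ∣*-split a b (∣ᶜ-head ∣f) (∣ᶜ-head ∣g)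
         (subst (_ ∣_) (coeff-∷⊗-zero c f (e ∷ g)) (∣-coeff ∣fg zero)))
    where
    drop-c : p ^ᶻ suc a ∣ c → p ^ᶻ suc (a ℕ.+ b) ∣ᶜ f ⊗ (e ∷ g)
    drop-c ∣c = coeffs-∣ λ k →
      ∣ᶻ.∣m+n∣m⇒∣n (subst (_ ∣_) (coeff-∷⊗-suc c f (e ∷ g) k) (∣-coeff ∣fg (suc k)))
        (subst (_∣ _) (sym (^ᶻ-+ p (suc a) b)) (*-pres-∣ ∣c (∣-coeff ∣g (suc k))))
    drop-e : p ^ᶻ suc b ∣ e → p ^ᶻ suc (a ℕ.+ b) ∣ᶜ (c ∷ f) ⊗ g
    drop-e ∣e = coeffs-∣ λ k →
      ∣ᶻ.∣m+n∣m⇒∣n (subst (_ ∣_) (coeff-⊗∷-suc (c ∷ f) e g k) (∣-coeff ∣fg (suc k)))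
        (subst (_∣ _) (trans (sym (^ᶻ-+ p a (suc b))) (cong (p ^ᶻ_) (ℕ.+-suc a b)))
          (*-pres-∣ (∣-coeff ∣f (suc k)) ∣e))

  gauss : ∀ n f g → p ^ᶻ n ∣ᶜ f ⊗ g →
          ∃₂ λ a b → a ℕ.+ b ≡ n × p ^ᶻ a ∣ᶜ f × p ^ᶻ b ∣ᶜ g
  gauss zero    f g _    = 0 , 0 , refl , 1∣ᶜ f , 1∣ᶜ g
  gauss (suc n) f g ∣fg with gauss n f g (∣-∣ᶜ-trans (^ᶻ∣^ᶻsuc p n) ∣fg)
  ... | a , b , refl , ∣f , ∣g with gauss-step a b f g ∣fg ∣f ∣g
  ...   | inj₁ ∣f′ = suc a , b , refl , ∣f′ , ∣g
  ...   | inj₂ ∣g′ = a , suc b , ℕ.+-suc a b , ∣f , ∣g′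

-- Type 2 in terms of the dilation f(2x)

∣-≡0 : ∀ {d y} → y ≡ 0ℤ → d ∣ y
∣-≡0 {d} refl = ∣-zero d

^ᶻ-shift-∣ : ∀ d k i {x} → d ^ᶻ i ∣ x → d ^ᶻ (k ℕ.+ i) ∣ d ^ᶻ k * x
^ᶻ-shift-∣ d k i {x} dⁱ∣x = subst (_∣ d ^ᶻ k * x) (sym (^ᶻ-+ d k i)) (∣ᶻ.*-monoʳ-∣ (d ^ᶻ k) dⁱ∣x)

^ᶻ-unshift-∣ : ∀ d .{{_ : ℕ.NonZero d}} k i {x} → d ^ᶻ (k ℕ.+ i) ∣ d ^ᶻ k * x → d ^ᶻ i ∣ x
^ᶻ-unshift-∣ d k i {x} h = ∣ᶻ.*-cancelˡ-∣ (d ^ᶻ k) {{ℕ.m^n≢0 d k}} (subst (_∣ d ^ᶻ k * x) (^ᶻ-+ d k i) h)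

-- scale (+ d) (dilate d f) is the tail of dilate d (a ∷ f).
coeff-scale-dilate : ∀ d f k → coeff (scale (+ d) (dilate d f)) k ≡ d ^ᶻ suc k * coeff f k
coeff-scale-dilate d f k = coeff-dilate d (0ℤ ∷ f) (suc k)

[m∸n]∸1≡m∸[1+n] : ∀ m n → (m ∸ n) ∸ 1 ≡ m ∸ suc n
[m∸n]∸1≡m∸[1+n] m n = trans (∸1≡pred (m ∸ n)) (ℕ.pred[m∸n]≡m∸[1+n] m n)
  where
  ∸1≡pred : ∀ n → n ∸ 1 ≡ ℕ.pred n
  ∸1≡pred zero    = refl
  ∸1≡pred (suc n) = refl

type2⇒∣ᶜdilate : ∀ {f m} → HasDegree f m → Type2 f → 2 ^ᶻ m ∣ᶜ dilate 2 f
type2⇒∣ᶜdilate {f} {m} deg type2 =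
  coeffs-∣ λ k → subst (_ ∣_) (sym (coeff-dilate 2 f k)) (go k (k ℕ.≤? m))
  where
  go : ∀ k → Dec (k ≤ m) → 2 ^ᶻ m ∣ 2 ^ᶻ k * coeff f k
  go k (yes k≤m) = subst₂ (λ i j → 2 ^ᶻ i ∣ 2 ^ᶻ k * coeff f j) (ℕ.m+[n∸m]≡n k≤m) (ℕ.m∸[m∸n]≡n k≤m)
    (^ᶻ-shift-∣ 2 k (m ∸ k) (∣ᶻ.∣ᵤ⇒∣ (type2 m deg (m ∸ k) (ℕ.m∸n≤m m k))))
  go k (no k≰m)  = ∣ᶻ.∣n⇒∣m*n (2 ^ᶻ k) (∣-≡0 (proj₂ deg k (ℕ.≰⇒> k≰m)))

∣ᶜdilate⇒type2 : ∀ {f m} → HasDegree f m → 2 ^ᶻ m ∣ᶜ dilate 2 f → Type2 f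
∣ᶜdilate⇒type2 {f} {m} deg ∣f₂ n deg′ i i≤n with hasDegree-unique {f} deg deg′
... | refl = ∣ᶻ.∣⇒∣ᵤ (^ᶻ-unshift-∣ 2 (m ∸ i) i
  (subst₂ (λ j → 2 ^ᶻ j ∣_) (sym (ℕ.m∸n+n≡m i≤n)) (coeff-dilate 2 f (m ∸ i)) (∣-coeff ∣f₂ (m ∸ i))))

weaklyType2⇒∣ᶜdilate : ∀ {f m} → HasDegree f m → WeaklyType2 f →
                       2 ^ᶻ m ∣ᶜ scale (+ 2) (dilate 2 f)
weaklyType2⇒∣ᶜdilate {f} {m} deg weak =
  coeffs-∣ λ k → subst (_ ∣_) (sym (coeff-scale-dilate 2 f k)) (go k (ℕ.<-cmp k m))
  where
  go : ∀ k → Tri (k < m) (k ≡ m) (m < k) → 2 ^ᶻ m ∣ 2 ^ᶻ suc k * coeff f k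
  go k (tri< k<m _ _) = subst₂ (λ i j → 2 ^ᶻ i ∣ 2 ^ᶻ suc k * coeff f j)
    (trans (cong (suc k ℕ.+_) ([m∸n]∸1≡m∸[1+n] m k)) (ℕ.m+[n∸m]≡n k<m)) (ℕ.m∸[m∸n]≡n (ℕ.<⇒≤ k<m))
    (^ᶻ-shift-∣ 2 (suc k) _ (∣ᶻ.∣ᵤ⇒∣ (weak m deg (m ∸ k) (ℕ.m<n⇒0<n∸m k<m) (ℕ.m∸n≤m m k))))
  go k (tri≈ _ refl _) = ∣ᶻ.∣m⇒∣m*n (coeff f k) (^ᶻ∣^ᶻsuc 2 k)
  go k (tri> _ _ m<k) = ∣ᶻ.∣n⇒∣m*n (2 ^ᶻ suc k) (∣-≡0 (proj₂ deg k m<k))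

∣ᶜdilate⇒weaklyType2 : ∀ {f m} → HasDegree f m → 2 ^ᶻ m ∣ᶜ scale (+ 2) (dilate 2 f) →
                       WeaklyType2 f
∣ᶜdilate⇒weaklyType2 {f} {m} deg ∣2f₂ n deg′ (suc i) _ i<n with hasDegree-unique {f} deg deg′
... | refl = ∣ᶻ.∣⇒∣ᵤ (^ᶻ-unshift-∣ 2 (suc (m ∸ suc i)) i
  (subst₂ (λ j → 2 ^ᶻ j ∣_) exponent (coeff-scale-dilate 2 f (m ∸ suc i)) (∣-coeff ∣2f₂ (m ∸ suc i))))
  where
  exponent : m ≡ suc (m ∸ suc i) ℕ.+ i
  exponent = sym (trans (sym (ℕ.+-suc (m ∸ suc i) i)) (ℕ.m∸n+n≡m i<n))

type2⇒weaklyType2 : ∀ f → Type2 f → WeaklyType2 f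
type2⇒weaklyType2 f type2 n deg (suc i) _ i<n = ℕ.∣-trans (ℕ.n∣m*n 2) (type2 n deg (suc i) i<n)

^ᶻ∣^ᶻ*unit⇒≤ : ∀ {d} → 1 < d → ∀ {c j x} → ℤ.∣ x ∣ ≡ 1 → d ^ᶻ c ∣ d ^ᶻ j * x → c ≤ j
^ᶻ∣^ᶻ*unit⇒≤ {d} 1<d@(s≤s (s≤s z≤n)) {c} {j} {x} ∣x∣≡1 dᶜ∣dʲx =
  ℕ.≮⇒≥ λ j<c → ℕ.<⇒≱ (ℕ.^-monoʳ-< d 1<d j<c) (ℕ.∣⇒≤ {{ℕ.m^n≢0 d j}} dᶜ∣dʲ)
  where
  dᶜ∣dʲ : d ^ c ℕ.∣ d ^ j
  dᶜ∣dʲ = subst (d ^ c ℕ.∣_)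
    (trans (ℤ.abs-* (d ^ᶻ j) x) (trans (cong (d ^ j ℕ.*_) ∣x∣≡1) (ℕ.*-identityʳ (d ^ j))))
    (∣ᶻ.∣⇒∣ᵤ dᶜ∣dʲx)

*≡1⇒∣∣≡1 : ∀ x y → x * y ≡ 1ℤ → ℤ.∣ x ∣ ≡ 1 × ℤ.∣ y ∣ ≡ 1
*≡1⇒∣∣≡1 x y xy≡1 = ℕ.m*n≡1⇒m≡1 ℤ.∣ x ∣ ℤ.∣ y ∣ ∣x∣∣y∣≡1 , ℕ.m*n≡1⇒n≡1 ℤ.∣ x ∣ ℤ.∣ y ∣ ∣x∣∣y∣≡1
  where
  ∣x∣∣y∣≡1 : ℤ.∣ x ∣ ℕ.* ℤ.∣ y ∣ ≡ 1
  ∣x∣∣y∣≡1 = trans (sym (ℤ.abs-* x y)) (cong ℤ.∣_∣ xy≡1)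

+-≤-tight : ∀ {a b m l} → a ≤ m → b ≤ l → a ℕ.+ b ≡ m ℕ.+ l → a ≡ m × b ≡ l
+-≤-tight {a} {b} {m} {l} a≤m b≤l a+b≡m+l = a≡m , ℕ.+-cancelˡ-≡ m b l (subst (λ i → i ℕ.+ b ≡ m ℕ.+ l) a≡m a+b≡m+l)
  where
  a≡m : a ≡ m
  a≡m = ℕ.≤-antisym a≤m (ℕ.≮⇒≥ λ a<m → ℕ.<-irrefl a+b≡m+l (ℕ.+-mono-<-≤ a<m b≤l))

+-≤-tight-suc : ∀ {a b m l} → a ≤ suc m → b ≤ l → a ℕ.+ b ≡ m ℕ.+ l →
                (a ≡ m × b ≡ l) ⊎ (a ≡ suc m × suc b ≡ l)
+-≤-tight-suc {a} {b} {m} {l} a≤1+m b≤l a+b≡m+l with ℕ.m≤n⇒m<n∨m≡n a≤1+m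
... | inj₁ (s≤s a≤m) = inj₁ (+-≤-tight a≤m b≤l a+b≡m+l)
... | inj₂ refl      = inj₂ (refl , ℕ.+-cancelˡ-≡ m (suc b) l (trans (ℕ.+-suc m b) a+b≡m+l))

record MonicFactorisation (p q r : Poly) : Set where
  field
    m l    : ℕ
    p≈q⊗r  : p ≈P (q ⊗ r)
    deg-p  : HasDegree p (m ℕ.+ l)
    deg-q  : HasDegree q m
    deg-r  : HasDegree r l
    unit-q : ℤ.∣ coeff q m ∣ ≡ 1
    unit-r : ℤ.∣ coeff r l ∣ ≡ 1

monic⇒≉[] : ∀ {f} → Monic f → ¬ f ≈P []
monic⇒≉[] (d , _ , f_d≡1) f≈0 with trans (sym f_d≡1) (f≈0 d)
... | ()

monicFactorisation : ∀ p q r → Monic p → p ≈P (q ⊗ r) → MonicFactorisation p q r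
monicFactorisation p q r monic@(n , deg-p , pₙ≡1) p≈q⊗r with zero⊎hasDegree q | zero⊎hasDegree r
... | inj₁ q≈0 | _        = ⊥-elim (monic⇒≉[] {p} monic (λ k → trans (p≈q⊗r k) (⊗-zeroˡ q r q≈0 k)))
... | inj₂ _   | inj₁ r≈0 = ⊥-elim (monic⇒≉[] {p} monic (λ k → trans (p≈q⊗r k) (⊗-zeroʳ q r r≈0 k)))
... | inj₂ (m , deg-q) | inj₂ (l , deg-r) = record
  { m = m ; l = l ; p≈q⊗r = p≈q⊗r ; deg-p = deg-p′ ; deg-q = deg-q ; deg-r = deg-r
  ; unit-q = proj₁ units ; unit-r = proj₂ units }
  where
  deg-p′ : HasDegree p (m ℕ.+ l)
  deg-p′ = hasDegree-resp-≈ {p} {q ⊗ r} p≈q⊗r (⊗-hasDegree {q} {r} deg-q deg-r)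
  lead-product : coeff q m * coeff r l ≡ 1ℤ
  lead-product = begin
    coeff q m * coeff r l     ≡⟨ coeff-⊗-top q r m l (proj₂ deg-q) (proj₂ deg-r) ⟨
    coeff (q ⊗ r) (m ℕ.+ l)   ≡⟨ p≈q⊗r (m ℕ.+ l) ⟨
    coeff p (m ℕ.+ l)         ≡⟨ cong (coeff p) (hasDegree-unique {p} deg-p deg-p′) ⟨
    coeff p n                 ≡⟨ pₙ≡1 ⟩
    1ℤ                        ∎
    where open ≡-Reasoning
  units : ℤ.∣ coeff q m ∣ ≡ 1 × ℤ.∣ coeff r l ∣ ≡ 1
  units = *≡1⇒∣∣≡1 (coeff q m) (coeff r l) lead-product

∣ᶜdilate⇒≤ : ∀ {f m c} → ℤ.∣ coeff f m ∣ ≡ 1 → 2 ^ᶻ c ∣ᶜ dilate 2 f → c ≤ m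
∣ᶜdilate⇒≤ {f} {m} unit ∣f₂ =
  ^ᶻ∣^ᶻ*unit⇒≤ (s≤s (s≤s z≤n)) unit (subst (_ ∣_) (coeff-dilate 2 f m) (∣-coeff ∣f₂ m))

∣ᶜscale-dilate⇒≤ : ∀ {f m c} → ℤ.∣ coeff f m ∣ ≡ 1 → 2 ^ᶻ c ∣ᶜ scale (+ 2) (dilate 2 f) → c ≤ suc m
∣ᶜscale-dilate⇒≤ {f} {m} unit ∣2f₂ =
  ^ᶻ∣^ᶻ*unit⇒≤ (s≤s (s≤s z≤n)) unit (subst (_ ∣_) (coeff-scale-dilate 2 f m) (∣-coeff ∣2f₂ m))

module _ {p q r : Poly} (F : MonicFactorisation p q r) where
  open MonicFactorisation F

  private
    prime-2 : Prime 2
    prime-2 = from-yes (prime? 2)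

    p₂≈q₂⊗r₂ : dilate 2 p ≈P (dilate 2 q ⊗ dilate 2 r)
    p₂≈q₂⊗r₂ k = trans (coeff-dilate 2 p k) (trans (cong (2 ^ᶻ k *_) (p≈q⊗r k)) (sym (coeff-dilate-⊗ 2 q r k)))

    2p₂≈2q₂⊗r₂ : scale (+ 2) (dilate 2 p) ≈P (scale (+ 2) (dilate 2 q) ⊗ dilate 2 r)
    2p₂≈2q₂⊗r₂ k = trans (coeff-scale (+ 2) (dilate 2 p) k)
      (trans (cong (+ 2 *_) (p₂≈q₂⊗r₂ k)) (sym (coeff-scale-⊗ (+ 2) (dilate 2 q) (dilate 2 r) k)))

    2p₂≈q₂⊗2r₂ : scale (+ 2) (dilate 2 p) ≈P (dilate 2 q ⊗ scale (+ 2) (dilate 2 r))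
    2p₂≈q₂⊗2r₂ k = trans (coeff-scale (+ 2) (dilate 2 p) k)
      (trans (cong (+ 2 *_) (p₂≈q₂⊗r₂ k)) (sym (coeff-⊗-scale (+ 2) (dilate 2 q) (dilate 2 r) k)))

  type2-factors : Type2 p → Type2 q × Type2 r
  type2-factors type2-p
    with gauss prime-2 (m ℕ.+ l) (dilate 2 q) (dilate 2 r)
           (∣ᶜ-resp-≈ p₂≈q₂⊗r₂ (type2⇒∣ᶜdilate {p} deg-p type2-p))
  ... | a , b , a+b≡m+l , ∣q₂ , ∣r₂
    with +-≤-tight {a} {b} (∣ᶜdilate⇒≤ {q} unit-q ∣q₂) (∣ᶜdilate⇒≤ {r} unit-r ∣r₂) a+b≡m+l
  ... | refl , refl = ∣ᶜdilate⇒type2 {q} deg-q ∣q₂ , ∣ᶜdilate⇒type2 {r} deg-r ∣r₂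

  type2-product : Type2 q → Type2 r → Type2 p
  type2-product type2-q type2-r = ∣ᶜdilate⇒type2 {p} deg-p (∣ᶜ-resp-≈ (λ k → sym (p₂≈q₂⊗r₂ k))
    (^ᶻ∣ᶜ-⊗ 2 m l (type2⇒∣ᶜdilate {q} deg-q type2-q) (type2⇒∣ᶜdilate {r} deg-r type2-r)))

  weaklyType2-factors : WeaklyType2 p → (WeaklyType2 q × WeaklyType2 r) × (Type2 q ⊎ Type2 r)
  weaklyType2-factors weak-p
    with gauss prime-2 (m ℕ.+ l) (scale (+ 2) (dilate 2 q)) (dilate 2 r)
           (∣ᶜ-resp-≈ 2p₂≈2q₂⊗r₂ (weaklyType2⇒∣ᶜdilate {p} deg-p weak-p))
  ... | a , b , a+b≡m+l , ∣2q₂ , ∣r₂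
    with +-≤-tight-suc {a} {b} (∣ᶜscale-dilate⇒≤ {q} unit-q ∣2q₂) (∣ᶜdilate⇒≤ {r} unit-r ∣r₂) a+b≡m+l
  ... | inj₁ (refl , refl) =
    (∣ᶜdilate⇒weaklyType2 {q} deg-q ∣2q₂ , type2⇒weaklyType2 r type2-r) , inj₂ type2-r
    where
    type2-r : Type2 r
    type2-r = ∣ᶜdilate⇒type2 {r} deg-r ∣r₂
  ... | inj₂ (refl , 1+b≡l) =
    (type2⇒weaklyType2 q type2-q , ∣ᶜdilate⇒weaklyType2 {r} deg-r ∣2r₂) , inj₁ type2-q
    where
    type2-q : Type2 q
    type2-q = ∣ᶜdilate⇒type2 {q} deg-q
      (∣ᶜ-scale-cancel (+ 2) (subst (_∣ᶜ _) (^ᶻ-suc 2 m) ∣2q₂))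
    ∣2r₂ : 2 ^ᶻ l ∣ᶜ scale (+ 2) (dilate 2 r)
    ∣2r₂ = subst (λ i → 2 ^ᶻ i ∣ᶜ _) 1+b≡l
      (subst (_∣ᶜ _) (sym (^ᶻ-suc 2 b)) (∣ᶜ-scale (+ 2) ∣r₂))

  weaklyType2-product : (WeaklyType2 q × WeaklyType2 r) × (Type2 q ⊎ Type2 r) → WeaklyType2 p
  weaklyType2-product ((_ , weak-r) , inj₁ type2-q) =
    ∣ᶜdilate⇒weaklyType2 {p} deg-p (∣ᶜ-resp-≈ (λ k → sym (2p₂≈q₂⊗2r₂ k))
      (^ᶻ∣ᶜ-⊗ 2 m l (type2⇒∣ᶜdilate {q} deg-q type2-q) (weaklyType2⇒∣ᶜdilate {r} deg-r weak-r)))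
  weaklyType2-product ((weak-q , _) , inj₂ type2-r) =
    ∣ᶜdilate⇒weaklyType2 {p} deg-p (∣ᶜ-resp-≈ (λ k → sym (2p₂≈2q₂⊗r₂ k))
      (^ᶻ∣ᶜ-⊗ 2 m l (weaklyType2⇒∣ᶜdilate {q} deg-q weak-q) (type2⇒∣ᶜdilate {r} deg-r type2-r)))

lemma2p8 : (p q r : Poly) → Monic p → p ≈P (q ⊗ r) →
    (Type2 p ⇔ (Type2 q × Type2 r)) ×
    (WeaklyType2 p ⇔ ((WeaklyType2 q × WeaklyType2 r) × (Type2 q ⊎ Type2 r)))
lemma2p8 p q r monic p≈q⊗r =
  mk⇔ (type2-factors F) (uncurry (type2-product F)) ,
  mk⇔ (weaklyType2-factors F) (weaklyType2-product F)
  where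
  F : MonicFactorisation p q r
  F = monicFactorisation p q r monic p≈q⊗r
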